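{- Let $\mathcal{V}$ be a quantaloid and $\mathbb{A},\mathbb{B}$ be $\mathcal{V}$-categories. Then $\mathbb{A}$ and $\mathbb{B}$ are bisimilar if and only if there exist a $\mathcal{V}$-category $\mathbb{C}$ and functional bisimulations $f:\mathbb{A}\to\mathbb{C}$, $g:\mathbb{B}\to\mathbb{C}$ that are surjective on objects.
   Context: A quantaloid $\mathcal{V}$ is a small, locally ordered bicategory whose hom-posets are complete lattices and which is biclosed (for every arrow $f$, $-\otimes f$ and $f\otimes -$ have right adjoints, $\otimes$ = horizontal composition in diagrammatic order); so $\otimes$ preserves arbitrary joins in each variable. A $\mathcal{V}$-category $\mathbb{A}$: a set $\mathrm{Obj}(\mathbb{A})$, a map $a\mapsto a_+\in\mathrm{Obj}(\mathcal{V})$, arrows $\mathbb{A}(a,b):a_+\to b_+$ with $id_{a_+}\le\mathbb{A}(a,a)$, $\mathbb{A}(a,b)\otimes\mathbb{A}(b,c)\le\mathbb{A}(a,c)$. A $\mathcal{V}$-functor $f:\mathbb{A}\to\mathbb{B}$: a map on objects with $(fa)_+=a_+$ and $\mathbb{A}(a,a')\le\mathbb{B}(fa,fa')$. A simulation from $\mathbb{A}$ to $\mathbb{B}$: a relation $R\subseteq\mathrm{Obj}(\mathbb{A})\times\mathrm{Obj}(\mathbb{B})$ with $(a,b)\in R\Rightarrow a_+=b_+$ and $\mathbb{A}(a,a')\le\bigvee_{b':(a',b')\in R}\mathbb{B}(b,b')$ for all $(a,b)\in R$, $a'\in\mathrm{Obj}(\mathbb{A})$; a bisimulation: $R$ and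 $R^{ -1}$ are simulations. $\mathbb{A},\mathbb{B}$ are bisimilar if there is a bisimulation from $\mathbb{A}$ to $\mathbb{B}$ relating every object of $\mathbb{A}$ to some object of $\mathbb{B}$ and every object of $\mathbb{B}$ to some object of $\mathbb{A}$. A functional bisimulation is a $\mathcal{V}$-functor $f:\mathbb{A}\to\mathbb{B}$ such that $\mathbb{B}(f(a),b)=\bigvee_{a':f(a')=b}\mathbb{A}(a,a')$ for all $a\in\mathrm{Obj}(\mathbb{A})$, $b\in\mathrm{Obj}(\mathbb{B})$ (equivalently, its graph $\{(a,fa)\}$ is a bisimulation). -}

module Defs where

open import Level using (Level; _⊔_; suc)
open import Data.Product using (Σ; Σ-syntax; ∃; _×_; _,_; proj₁; proj₂)
open import Relation.Binary.PropositionalEquality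
  using (_≡_; refl; sym; trans; subst₂; cong)
open import Relation.Binary.Bundles using (Setoid)

-- Composition _⊗_ is in diagrammatic order.

record Quantaloid (o h r ι : Level) : Set (suc (o ⊔ h ⊔ r ⊔ ι)) where
  infixr 7 _⊗_
  infix  4 _≤_
  field
    Ob   : Set o
    Hom  : Ob → Ob → Set h
    _≤_  : ∀ {X Y} → Hom X Y → Hom X Y → Set r
    ≤-refl    : ∀ {X Y} {f : Hom X Y} → f ≤ f
    ≤-trans   : ∀ {X Y} {f g k : Hom X Y} → f ≤ g → g ≤ k → f ≤ k
    ≤-antisym : ∀ {X Y} {f g : Hom X Y} → f ≤ g → g ≤ f → f ≡ g
    ⋁        : ∀ {X Y} {I : Set ι} → (I → Hom X Y) → Hom X Y
    ⋁-upper  : ∀ {X Y} {I : Set ι} (F : I → Hom X Y) (i : I) → F i ≤ ⋁ F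
    ⋁-least  : ∀ {X Y} {I : Set ι} (F : I → Hom X Y) (g : Hom X Y) →
               (∀ i → F i ≤ g) → ⋁ F ≤ g
    idV      : ∀ X → Hom X X
    _⊗_      : ∀ {X Y Z} → Hom X Y → Hom Y Z → Hom X Z
    ⊗-mono   : ∀ {X Y Z} {f f' : Hom X Y} {g g' : Hom Y Z} →
               f ≤ f' → g ≤ g' → f ⊗ g ≤ f' ⊗ g'
    ⊗-assoc  : ∀ {W X Y Z} (f : Hom W X) (g : Hom X Y) (k : Hom Y Z) →
               (f ⊗ g) ⊗ k ≡ f ⊗ (g ⊗ k)
    ⊗-idˡ    : ∀ {X Y} (f : Hom X Y) → idV X ⊗ f ≡ f
    ⊗-idʳ    : ∀ {X Y} (f : Hom X Y) → f ⊗ idV Y ≡ f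
    _↙_      : ∀ {W X Y} → Hom W Y → Hom X Y → Hom W X
    ↙-adj    : ∀ {W X Y} (g : Hom W X) (f : Hom X Y) (k : Hom W Y) →
               ((g ⊗ f ≤ k) → (g ≤ k ↙ f)) × ((g ≤ k ↙ f) → (g ⊗ f ≤ k))
    _↘_      : ∀ {X Y Z} → Hom X Y → Hom X Z → Hom Y Z
    ↘-adj    : ∀ {X Y Z} (f : Hom X Y) (g : Hom Y Z) (k : Hom X Z) →
               ((f ⊗ g ≤ k) → (g ≤ f ↘ k)) × ((g ≤ f ↘ k) → (f ⊗ g ≤ k))

-- The object sets
-- of V-categories are rendered as setoids (Agda has no quotient types);
-- all structure is required to respect the setoid equality.

module _ {o h r ℓ : Level} (V : Quantaloid o h r ℓ) where
  open Quantaloid V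

  tr : ∀ {X X' Y Y'} → X ≡ X' → Y ≡ Y' → Hom X Y → Hom X' Y'
  tr p q f = subst₂ Hom p q f

  record VCat : Set (o ⊔ h ⊔ r ⊔ suc ℓ) where
    field
      objs    : Setoid ℓ ℓ
    open Setoid objs public renaming (Carrier to Obj; _≈_ to _≈ₒ_)
    field
      ty      : Obj → Ob
      hom     : (a b : Obj) → Hom (ty a) (ty b)
      ty-resp : ∀ {a a'} → a ≈ₒ a' → ty a ≡ ty a'
      hom-resp : ∀ {a a' b b'} (p : a ≈ₒ a') (q : b ≈ₒ b') →
                 tr (ty-resp p) (ty-resp q) (hom a b) ≡ hom a' b'
      hom-id   : ∀ a → idV (ty a) ≤ hom a a
      hom-comp : ∀ a b c → hom a b ⊗ hom b c ≤ hom a c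

  open VCat using (Obj; _≈ₒ_; ty; hom; ty-resp)

  record VFunctor (A B : VCat) : Set (o ⊔ h ⊔ r ⊔ ℓ) where
    field
      fun      : Obj A → Obj B
      fun-resp : ∀ {a a'} → _≈ₒ_ A a a' → _≈ₒ_ B (fun a) (fun a')
      fun-ty   : ∀ a → ty B (fun a) ≡ ty A a
      fun-hom  : ∀ a a' →
                 hom A a a' ≤ tr (fun-ty a) (fun-ty a') (hom B (fun a) (fun a'))

  open VFunctor using (fun; fun-ty)

  record IsSimulation (A B : VCat) (R : Obj A → Obj B → Set ℓ)
         : Set (o ⊔ h ⊔ r ⊔ ℓ) where
    field
      rel-ty : ∀ {a b} → R a b → ty A a ≡ ty B b
      sim    : ∀ {a b} (rab : R a b) (a' : Obj A) →
               hom A a a' ≤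
                 ⋁ {I = Σ[ b' ∈ Obj B ] R a' b'}
                   (λ { (b' , r') → tr (sym (rel-ty rab)) (sym (rel-ty r'))
                                       (hom B b b') })

  IsBisimulation : (A B : VCat) → (Obj A → Obj B → Set ℓ) → Set (o ⊔ h ⊔ r ⊔ ℓ)
  IsBisimulation A B R =
    IsSimulation A B R × IsSimulation B A (λ b a → R a b)

  Bisimilar : VCat → VCat → Set (o ⊔ h ⊔ r ⊔ suc ℓ)
  Bisimilar A B =
    Σ[ R ∈ (Obj A → Obj B → Set ℓ) ]
      IsBisimulation A B R
      × (∀ a → Σ[ b ∈ Obj B ] R a b)
      × (∀ b → Σ[ a ∈ Obj A ] R a b)

  IsFunctionalBisimulation : (A B : VCat) → VFunctor A B → Set (h ⊔ ℓ)
  IsFunctionalBisimulation A B f =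
    ∀ (a : Obj A) (b : Obj B) →
      hom B (fun f a) b ≡
        ⋁ {I = Σ[ a' ∈ Obj A ] _≈ₒ_ B (fun f a') b}
          (λ { (a' , p) → tr (sym (fun-ty f a))
                             (trans (sym (fun-ty f a')) (ty-resp B p))
                             (hom A a a') })

  SurjectiveOnObjects : (A B : VCat) → VFunctor A B → Set ℓ
  SurjectiveOnObjects A B f = ∀ (b : Obj B) → Σ[ a ∈ Obj A ] _≈ₒ_ B (fun f a) b

{-# OPTIONS --safe #-}

-- Given a total and surjective bisimulation R between 𝔸 and 𝔹, the equivalence relation ∼
-- generated by R on the coproduct 𝔸 ⊕ 𝔹 is still a simulation, since simulations are closed
-- under converse (R being a bisimulation), union and composition.  Quotienting 𝔸 ⊕ 𝔹 by ∼,
-- with hom(x, y) = ⋁_{z ∼ y} hom(x, z), gives a V-category ℂ into which both injections are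
-- functional bisimulations, surjective because R is total and surjective.  Conversely, for
-- functional bisimulations f : 𝔸 → ℂ ← 𝔹 : g the relation f a ≈ g b is a bisimulation:
-- 𝔸(a, a′) ≤ ℂ(f a, f a′) = ℂ(g b, f a′) = ⋁_{g b′ ≈ f a′} 𝔹(b, b′).
module Submission where

open import Defs
open import Level using (Level; _⊔_)
open import Data.Empty.Polymorphic as Empty using ()
open import Data.Product using (Σ; Σ-syntax; _×_; _,_; proj₁; proj₂)
open import Data.Sum using (_⊎_; inj₁; inj₂)
open import Data.Sum.Relation.Binary.Pointwise using (Pointwise; inj₁; inj₂; ⊎-setoid)
open import Function.Bundles using (_⇔_; mk⇔)
open import Relation.Binary.Structures using (IsEquivalence)
open import Relation.Binary.PropositionalEquality using (_≡_; refl; sym; trans)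
open import Relation.Binary.Construct.Closure.ReflexiveTransitive as Star
  using (Star; ε; _◅_; _◅◅_)

module QuantaloidProperties {o h r ℓ : Level} (V : Quantaloid o h r ℓ) where
  open Quantaloid V

  private variable
    X X₁ Y Y₁ Z Z₁ : Ob
    I J : Set ℓ

  ≤-reflexive : {f g : Hom X Y} → f ≡ g → f ≤ g
  ≤-reflexive refl = ≤-refl

  ≤-⋁ : (G : I → Hom X Y) (j : I) {f : Hom X Y} → f ≤ G j → f ≤ ⋁ G
  ≤-⋁ G j f≤Gj = ≤-trans f≤Gj (⋁-upper G j)

  ⊗-distribʳ-⋁ : (F : I → Hom X Y) (g : Hom Y Z) → ⋁ F ⊗ g ≤ ⋁ (λ i → F i ⊗ g)
  ⊗-distribʳ-⋁ F g = proj₂ (↙-adj (⋁ F) g _)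
    (⋁-least F _ (λ i → proj₁ (↙-adj (F i) g _) (⋁-upper (λ i → F i ⊗ g) i)))

  ⊗-distribˡ-⋁ : (f : Hom X Y) (G : I → Hom Y Z) → f ⊗ ⋁ G ≤ ⋁ (λ i → f ⊗ G i)
  ⊗-distribˡ-⋁ f G = proj₂ (↘-adj f (⋁ G) _)
    (⋁-least G _ (λ i → proj₁ (↘-adj f (G i) _) (⋁-upper (λ i → f ⊗ G i) i)))

  ⊥ : Hom X Y
  ⊥ = ⋁ {I = Empty.⊥} λ ()

  ⊥-least : {f : Hom X Y} → ⊥ ≤ f
  ⊥-least {f = f} = ⋁-least _ f λ ()

  ⊥-⊗-least : {g : Hom Y Z} {k : Hom X Z} → ⊥ ⊗ g ≤ k
  ⊥-⊗-least {g = g} {k} = proj₂ (↙-adj ⊥ g k) ⊥-least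

  ⊗-⊥-least : {f : Hom X Y} {k : Hom X Z} → f ⊗ ⊥ ≤ k
  ⊗-⊥-least {f = f} {k} = proj₂ (↘-adj f ⊥ k) ⊥-least

  tr-⊥ : {p : X ≡ X₁} {q : Y ≡ Y₁} → tr V p q ⊥ ≡ ⊥
  tr-⊥ {p = refl} {refl} = refl

  infix 4 _≲_

  -- Facts about tr are stated through this record because Agda cannot infer the paths in
  -- equations between nested applications of tr.
  record _≲_ (f : Hom X Y) (g : Hom X₁ Y₁) : Set (o ⊔ r) where
    constructor ≲-intro
    field
      dom-≡ : X ≡ X₁
      cod-≡ : Y ≡ Y₁
      tr-≤  : tr V dom-≡ cod-≡ f ≤ g

  ≲⇒tr-≤ : {f : Hom X Y} {g : Hom X₁ Y₁} {p : X ≡ X₁} {q : Y ≡ Y₁} →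
           f ≲ g → tr V p q f ≤ g
  ≲⇒tr-≤ {p = refl} {refl} (≲-intro refl refl f≤g) = f≤g

  ≲⇒≤-tr : {f : Hom X Y} {g : Hom X₁ Y₁} {p : X₁ ≡ X} {q : Y₁ ≡ Y} →
           f ≲ g → f ≤ tr V p q g
  ≲⇒≤-tr {p = refl} {refl} (≲-intro refl refl f≤g) = f≤g

  ≲⇒≤ : {f g : Hom X Y} → f ≲ g → f ≤ g
  ≲⇒≤ = ≲⇒tr-≤ {p = refl} {q = refl}

  ≤⇒≲ : {f g : Hom X Y} → f ≤ g → f ≲ g
  ≤⇒≲ = ≲-intro refl refl

  ≲-refl : {f : Hom X Y} → f ≲ f
  ≲-refl = ≤⇒≲ ≤-refl

  ≲-trans : {f : Hom X Y} {g : Hom X₁ Y₁} {k : Hom Z Z₁} → f ≲ g → g ≲ k → f ≲ k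
  ≲-trans (≲-intro refl refl f≤g) (≲-intro refl refl g≤k) = ≤⇒≲ (≤-trans f≤g g≤k)

  tr-≲ : (f : Hom X Y) {p : X ≡ X₁} {q : Y ≡ Y₁} → tr V p q f ≲ f
  tr-≲ f {refl} {refl} = ≲-refl

  ≲-tr : (f : Hom X Y) {p : X ≡ X₁} {q : Y ≡ Y₁} → f ≲ tr V p q f
  ≲-tr f {refl} {refl} = ≲-refl

  tr-≲-tr : (f : Hom X Y) {p : X ≡ X₁} {q : Y ≡ Y₁} {p′ : X ≡ Z} {q′ : Y ≡ Z₁} →
            tr V p q f ≲ tr V p′ q′ f
  tr-≲-tr f = ≲-trans (tr-≲ f) (≲-tr f)

  ⊗-≲ : {f : Hom X Y} {g : Hom Y Z} {f′ : Hom X₁ Y₁} {g′ : Hom Y₁ Z₁} →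
        f ≲ f′ → g ≲ g′ → f ⊗ g ≲ f′ ⊗ g′
  ⊗-≲ (≲-intro refl refl f≤f′) (≲-intro refl refl g≤g′) = ≤⇒≲ (⊗-mono f≤f′ g≤g′)

  ⋁-≲ : {F : I → Hom X Y} {g : Hom X₁ Y₁} → X ≡ X₁ → Y ≡ Y₁ →
        (∀ i → F i ≲ g) → ⋁ F ≲ g
  ⋁-≲ refl refl F≲g = ≤⇒≲ (⋁-least _ _ λ i → ≲⇒≤ (F≲g i))

  tr-≤-⋁ : {f : Hom X₁ Y₁} {f′ : Hom X Y} {F : I → Hom X Y} {G : J → Hom Z Z₁}
           {p : X₁ ≡ Z} {q : Y₁ ≡ Z₁} → f ≲ f′ → f′ ≤ ⋁ F →
           (ι : I → J) → (∀ i → F i ≲ G (ι i)) → tr V p q f ≤ ⋁ G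
  tr-≤-⋁ {p = refl} {refl} (≲-intro refl refl f≤f′) f′≤⋁F ι F≲G∘ι =
    ≤-trans (≤-trans f≤f′ f′≤⋁F) (⋁-least _ _ λ i → ≤-⋁ _ (ι i) (≲⇒≤ (F≲G∘ι i)))

  ⋁-≤-⋁ : {F : I → Hom X Y} {G : J → Hom X Y} (ι : I → J) →
          (∀ i → F i ≲ G (ι i)) → ⋁ F ≤ ⋁ G
  ⋁-≤-⋁ = tr-≤-⋁ {p = refl} {q = refl} ≲-refl ≤-refl

module Simulations {o h r ℓ : Level} (V : Quantaloid o h r ℓ) where
  open Quantaloid V
  open QuantaloidProperties V
  open VCat using (Obj; _≈ₒ_; ty; hom; ty-resp; hom-resp)
  open VFunctor using (fun; fun-ty; fun-hom)
  open IsSimulation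

  hom-≲ : (𝔸 : VCat V) {a a′ b b′ : Obj 𝔸} → _≈ₒ_ 𝔸 a a′ → _≈ₒ_ 𝔸 b b′ →
          hom 𝔸 a b ≲ hom 𝔸 a′ b′
  hom-≲ 𝔸 a≈a′ b≈b′ = ≲-intro _ _ (≤-reflexive (hom-resp 𝔸 a≈a′ b≈b′))

  ≈-isSimulation : (𝔸 : VCat V) → IsSimulation V 𝔸 𝔸 (_≈ₒ_ 𝔸)
  ≈-isSimulation 𝔸 = record
    { rel-ty = ty-resp 𝔸
    ; sim    = λ a≈b a′ → ≤-⋁ _ (a′ , VCat.refl 𝔸) (≲⇒≤-tr (hom-≲ 𝔸 a≈b (VCat.refl 𝔸)))
    }

  isSimulation-resp-⇔ : {𝔸 𝔹 : VCat V} {R S : Obj 𝔸 → Obj 𝔹 → Set ℓ} →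
                        (∀ {a b} → R a b → S a b) → (∀ {a b} → S a b → R a b) →
                        IsSimulation V 𝔸 𝔹 R → IsSimulation V 𝔸 𝔹 S
  isSimulation-resp-⇔ {𝔹 = 𝔹} R⇒S S⇒R R-sim = record
    { rel-ty = λ s → rel-ty R-sim (S⇒R s)
    ; sim    = λ {_} {b} s a′ → ≤-trans (sim R-sim (S⇒R s) a′)
        (⋁-≤-⋁ (λ (b′ , r′) → b′ , R⇒S r′) (λ (b′ , _) → tr-≲-tr (hom 𝔹 b b′)))
    }

  Star-isSimulation : {𝔻 : VCat V} {S : Obj 𝔻 → Obj 𝔻 → Set ℓ} →
                      IsSimulation V 𝔻 𝔻 S → IsSimulation V 𝔻 𝔻 (Star S)
  Star-isSimulation {𝔻} {S} S-sim = record { rel-ty = Star-ty ; sim = Star-sim }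
    where
    Star-ty : ∀ {x y} → Star S x y → ty 𝔻 x ≡ ty 𝔻 y
    Star-ty = Star.fold _ (λ s → trans (rel-ty S-sim s)) refl

    Star-sim : ∀ {x y} (xy : Star S x y) z →
               hom 𝔻 x z ≤ ⋁ {I = Σ[ w ∈ Obj 𝔻 ] Star S z w}
                 (λ (w , zw) → tr V (sym (Star-ty xy)) (sym (Star-ty zw)) (hom 𝔻 y w))
    Star-sim ε                z = ⋁-upper _ (z , ε)
    Star-sim {y = y} (s ◅ xy) z = ≤-trans (sim S-sim s z) (⋁-least _ _ λ (w , s′) →
      tr-≤-⋁ ≲-refl (Star-sim xy w) (λ (v , wv) → v , s′ ◅ wv)
        (λ (v , _) → tr-≲-tr (hom 𝔻 y v)))

  cospan-isSimulation : {𝔸 𝔹 ℂ : VCat V} (f : VFunctor V 𝔸 ℂ) (g : VFunctor V 𝔹 ℂ) →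
    IsFunctionalBisimulation V 𝔹 ℂ g →
    IsSimulation V 𝔸 𝔹 (λ a b → _≈ₒ_ ℂ (fun f a) (fun g b))
  cospan-isSimulation {𝔹 = 𝔹} {ℂ} f g g-fb = record
    { rel-ty = λ {a} {b} fa≈gb →
        trans (sym (fun-ty f a)) (trans (ty-resp ℂ fa≈gb) (fun-ty g b))
    ; sim    = λ {a} {b} fa≈gb a′ → ≤-trans (fun-hom f a a′)
        (tr-≤-⋁ (hom-≲ ℂ fa≈gb (VCat.refl ℂ)) (≤-reflexive (g-fb b (fun f a′)))
          (λ (b′ , gb′≈fa′) → b′ , VCat.sym ℂ gb′≈fa′) (λ (b′ , _) → tr-≲-tr (hom 𝔹 b b′)))
    }

module Quotient {o h r ℓ : Level} {V : Quantaloid o h r ℓ} (𝔻 : VCat V)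
  (_∼_ : VCat.Obj 𝔻 → VCat.Obj 𝔻 → Set ℓ) (∼-isEquivalence : IsEquivalence _∼_)
  (∼-isSimulation : IsSimulation V 𝔻 𝔻 _∼_) where

  open Quantaloid V
  open QuantaloidProperties V
  open VCat 𝔻 using (Obj; ty; hom; hom-id; hom-comp)
  open IsSimulation ∼-isSimulation
  private module ∼ = IsEquivalence ∼-isEquivalence

  hom/ : (x y : Obj) → Hom (ty x) (ty y)
  hom/ x y = ⋁ {I = Σ[ z ∈ Obj ] z ∼ y} (λ (z , z∼y) → tr V refl (rel-ty z∼y) (hom x z))

  hom-≲-hom/ : ∀ {x x′ z y′} → x ∼ x′ → z ∼ y′ → hom x z ≲ hom/ x′ y′
  hom-≲-hom/ {x′ = x′} {z} x∼x′ z∼y′ = ≲-intro (rel-ty x∼x′) (rel-ty z∼y′)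
    (tr-≤-⋁ ≲-refl (sim x∼x′ z) (λ (w , z∼w) → w , ∼.trans (∼.sym z∼w) z∼y′)
      (λ (w , _) → tr-≲-tr (hom x′ w)))

  hom-≤-hom/ : ∀ x y → hom x y ≤ hom/ x y
  hom-≤-hom/ x y = ≲⇒≤ (hom-≲-hom/ ∼.refl ∼.refl)

  hom/-≲ : ∀ {x x′ y y′} → x ∼ x′ → y ∼ y′ → hom/ x y ≲ hom/ x′ y′
  hom/-≲ {x} x∼x′ y∼y′ = ⋁-≲ (rel-ty x∼x′) (rel-ty y∼y′) λ (z , z∼y) →
    ≲-trans (tr-≲ (hom x z)) (hom-≲-hom/ x∼x′ (∼.trans z∼y y∼y′))

  hom/-resp : ∀ {x x′ y y′} (x∼x′ : x ∼ x′) (y∼y′ : y ∼ y′) →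
              tr V (rel-ty x∼x′) (rel-ty y∼y′) (hom/ x y) ≡ hom/ x′ y′
  hom/-resp x∼x′ y∼y′ = ≤-antisym (≲⇒tr-≤ (hom/-≲ x∼x′ y∼y′))
                                  (≲⇒≤-tr (hom/-≲ (∼.sym x∼x′) (∼.sym y∼y′)))

  hom-⊗-hom/ : ∀ x y z → hom x y ⊗ hom/ y z ≤ hom/ x z
  hom-⊗-hom/ x y z = ≤-trans (⊗-distribˡ-⋁ _ _) (⋁-least _ _ λ (w , w∼z) →
    ≲⇒≤ (≲-trans (⊗-≲ ≲-refl (tr-≲ (hom y w)))
           (≲-trans (≤⇒≲ (hom-comp x y w)) (hom-≲-hom/ ∼.refl w∼z))))

  hom/-comp : ∀ x y z → hom/ x y ⊗ hom/ y z ≤ hom/ x z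
  hom/-comp x y z = ≤-trans (⊗-distribʳ-⋁ _ _) (⋁-least _ _ λ (w , w∼y) →
    ≲⇒≤ (≲-trans (⊗-≲ (tr-≲ (hom x w)) (hom/-≲ (∼.sym w∼y) ∼.refl))
           (≤⇒≲ (hom-⊗-hom/ x w z))))

  quotient : VCat V
  quotient = record
    { objs     = record { Carrier = Obj ; _≈_ = _∼_ ; isEquivalence = ∼-isEquivalence }
    ; ty       = ty
    ; hom      = hom/
    ; ty-resp  = rel-ty
    ; hom-resp = hom/-resp
    ; hom-id   = λ x → ≤-trans (hom-id x) (hom-≤-hom/ x x)
    ; hom-comp = hom/-comp
    }

module Coproduct {o h r ℓ : Level} {V : Quantaloid o h r ℓ} (𝔸 𝔹 : VCat V) where
  open Quantaloid V
  open QuantaloidProperties V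
  private
    module 𝔸 = VCat 𝔸
    module 𝔹 = VCat 𝔹

  ty⊕ : 𝔸.Obj ⊎ 𝔹.Obj → Ob
  ty⊕ (inj₁ a) = 𝔸.ty a
  ty⊕ (inj₂ b) = 𝔹.ty b

  hom⊕ : (x y : 𝔸.Obj ⊎ 𝔹.Obj) → Hom (ty⊕ x) (ty⊕ y)
  hom⊕ (inj₁ a) (inj₁ a′) = 𝔸.hom a a′
  hom⊕ (inj₁ a) (inj₂ b′) = ⊥
  hom⊕ (inj₂ b) (inj₁ a′) = ⊥
  hom⊕ (inj₂ b) (inj₂ b′) = 𝔹.hom b b′

  private
    _≈⊕_ : 𝔸.Obj ⊎ 𝔹.Obj → 𝔸.Obj ⊎ 𝔹.Obj → Set ℓ
    _≈⊕_ = Pointwise 𝔸._≈ₒ_ 𝔹._≈ₒ_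

  ty⊕-resp : ∀ {x y} → x ≈⊕ y → ty⊕ x ≡ ty⊕ y
  ty⊕-resp (inj₁ a≈a′) = 𝔸.ty-resp a≈a′
  ty⊕-resp (inj₂ b≈b′) = 𝔹.ty-resp b≈b′

  hom⊕-resp : ∀ {x x′ y y′} (x≈x′ : x ≈⊕ x′) (y≈y′ : y ≈⊕ y′) →
              tr V (ty⊕-resp x≈x′) (ty⊕-resp y≈y′) (hom⊕ x y) ≡ hom⊕ x′ y′
  hom⊕-resp (inj₁ a≈a′) (inj₁ a≈a″) = 𝔸.hom-resp a≈a′ a≈a″
  hom⊕-resp (inj₁ _)    (inj₂ _)    = tr-⊥
  hom⊕-resp (inj₂ _)    (inj₁ _)    = tr-⊥
  hom⊕-resp (inj₂ b≈b′) (inj₂ b≈b″) = 𝔹.hom-resp b≈b′ b≈b″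

  hom⊕-id : ∀ x → idV (ty⊕ x) ≤ hom⊕ x x
  hom⊕-id (inj₁ a) = 𝔸.hom-id a
  hom⊕-id (inj₂ b) = 𝔹.hom-id b

  hom⊕-comp : ∀ x y z → hom⊕ x y ⊗ hom⊕ y z ≤ hom⊕ x z
  hom⊕-comp (inj₁ a) (inj₁ a′) (inj₁ a″) = 𝔸.hom-comp a a′ a″
  hom⊕-comp (inj₁ _) (inj₁ _)  (inj₂ _)  = ⊗-⊥-least
  hom⊕-comp (inj₁ _) (inj₂ _)  _         = ⊥-⊗-least
  hom⊕-comp (inj₂ _) (inj₁ _)  _         = ⊥-⊗-least
  hom⊕-comp (inj₂ _) (inj₂ _)  (inj₁ _)  = ⊗-⊥-least
  hom⊕-comp (inj₂ b) (inj₂ b′) (inj₂ b″) = 𝔹.hom-comp b b′ b″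

  coproduct : VCat V
  coproduct = record
    { objs     = ⊎-setoid 𝔸.objs 𝔹.objs
    ; ty       = ty⊕
    ; hom      = hom⊕
    ; ty-resp  = ty⊕-resp
    ; hom-resp = hom⊕-resp
    ; hom-id   = hom⊕-id
    ; hom-comp = hom⊕-comp
    }

module BisimulationQuotient {o h r ℓ : Level} {V : Quantaloid o h r ℓ} (𝔸 𝔹 : VCat V)
  (R : VCat.Obj 𝔸 → VCat.Obj 𝔹 → Set ℓ) (R-isBisimulation : IsBisimulation V 𝔸 𝔹 R) where

  open Quantaloid V using (≤-trans; ≤-antisym; ⋁-upper; ⋁-least)
  open QuantaloidProperties V
  open Simulations V
  open Coproduct 𝔸 𝔹
  open IsSimulation
  private
    module 𝔸 = VCat 𝔸
    module 𝔹 = VCat 𝔹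
    module 𝔻 = VCat coproduct
    R-sim  = proj₁ R-isBisimulation
    R˘-sim = proj₂ R-isBisimulation

  data Step : 𝔻.Obj → 𝔻.Obj → Set ℓ where
    ≈-step  : ∀ {x y} → x 𝔻.≈ₒ y → Step x y
    R-step  : ∀ {a b} → R a b → Step (inj₁ a) (inj₂ b)
    R˘-step : ∀ {a b} → R a b → Step (inj₂ b) (inj₁ a)

  Step-sym : ∀ {x y} → Step x y → Step y x
  Step-sym (≈-step x≈y) = ≈-step (𝔻.sym x≈y)
  Step-sym (R-step r)   = R˘-step r
  Step-sym (R˘-step r)  = R-step r

  Step-isSimulation : IsSimulation V coproduct coproduct Step
  Step-isSimulation = record
    { rel-ty = λ { (≈-step x≈y) → 𝔻.ty-resp x≈y
                 ; (R-step r)   → rel-ty R-sim r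
                 ; (R˘-step r)  → rel-ty R˘-sim r }
    ; sim    = λ
      { {b = y} (≈-step x≈y) z → ≤-trans (sim (≈-isSimulation coproduct) x≈y z)
          (⋁-≤-⋁ (λ (w , z≈w) → w , ≈-step z≈w) (λ (w , _) → tr-≲-tr (hom⊕ y w)))
      ; {b = inj₂ b} (R-step r) (inj₁ a′) → ≤-trans (sim R-sim r a′)
          (⋁-≤-⋁ (λ (b′ , r′) → inj₂ b′ , R-step r′) (λ (b′ , _) → tr-≲-tr (𝔹.hom b b′)))
      ; (R-step _)  (inj₂ _) → ⊥-least
      ; (R˘-step _) (inj₁ _) → ⊥-least
      ; {b = inj₁ a} (R˘-step r) (inj₂ b′) → ≤-trans (sim R˘-sim r b′)
          (⋁-≤-⋁ (λ (a′ , r′) → inj₁ a′ , R˘-step r′) (λ (a′ , _) → tr-≲-tr (𝔸.hom a a′)))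
      }
    }

  _∼_ : 𝔻.Obj → 𝔻.Obj → Set ℓ
  _∼_ = Star Step

  ∼-isEquivalence : IsEquivalence _∼_
  ∼-isEquivalence = record { refl = ε ; sym = Star.reverse Step-sym ; trans = _◅◅_ }

  open Quotient coproduct _∼_ ∼-isEquivalence (Star-isSimulation Step-isSimulation)
    using (quotient; hom-≤-hom/) public

  ι₁ : VFunctor V 𝔸 quotient
  ι₁ = record
    { fun      = inj₁
    ; fun-resp = λ a≈a′ → ≈-step (inj₁ a≈a′) ◅ ε
    ; fun-ty   = λ _ → refl
    ; fun-hom  = λ a a′ → hom-≤-hom/ (inj₁ a) (inj₁ a′)
    }

  ι₂ : VFunctor V 𝔹 quotient
  ι₂ = record
    { fun      = inj₂
    ; fun-resp = λ b≈b′ → ≈-step (inj₂ b≈b′) ◅ ε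
    ; fun-ty   = λ _ → refl
    ; fun-hom  = λ b b′ → hom-≤-hom/ (inj₂ b) (inj₂ b′)
    }

  ι₁-isFunctionalBisimulation : IsFunctionalBisimulation V 𝔸 quotient ι₁
  ι₁-isFunctionalBisimulation a y = ≤-antisym
    (⋁-least _ _ λ { (inj₁ a′ , a′∼y) → ⋁-upper _ (a′ , a′∼y)
                   ; (inj₂ _  , _)    → ≤-trans (≤-reflexive tr-⊥) ⊥-least })
    (⋁-≤-⋁ (λ (a′ , a′∼y) → inj₁ a′ , a′∼y) (λ _ → ≲-refl))

  ι₂-isFunctionalBisimulation : IsFunctionalBisimulation V 𝔹 quotient ι₂
  ι₂-isFunctionalBisimulation b y = ≤-antisym
    (⋁-least _ _ λ { (inj₁ _  , _)    → ≤-trans (≤-reflexive tr-⊥) ⊥-least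
                   ; (inj₂ b′ , b′∼y) → ⋁-upper _ (b′ , b′∼y) })
    (⋁-≤-⋁ (λ (b′ , b′∼y) → inj₂ b′ , b′∼y) (λ _ → ≲-refl))

  ι₁-surjective : (∀ b → Σ[ a ∈ 𝔸.Obj ] R a b) → SurjectiveOnObjects V 𝔸 quotient ι₁
  ι₁-surjective R-surjective (inj₁ a) = a , ε
  ι₁-surjective R-surjective (inj₂ b) =
    proj₁ (R-surjective b) , R-step (proj₂ (R-surjective b)) ◅ ε

  ι₂-surjective : (∀ a → Σ[ b ∈ 𝔹.Obj ] R a b) → SurjectiveOnObjects V 𝔹 quotient ι₂
  ι₂-surjective R-total (inj₁ a) = proj₁ (R-total a) , R˘-step (proj₂ (R-total a)) ◅ ε
  ι₂-surjective R-total (inj₂ b) = b , ε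

FunctionalBisimulationCospan : {o h r ℓ : Level} (V : Quantaloid o h r ℓ) (𝔸 𝔹 : VCat V) →
                               Set (o ⊔ h ⊔ r ⊔ Level.suc ℓ)
FunctionalBisimulationCospan V 𝔸 𝔹 =
  Σ[ ℂ ∈ VCat V ] Σ[ f ∈ VFunctor V 𝔸 ℂ ] Σ[ g ∈ VFunctor V 𝔹 ℂ ]
    (IsFunctionalBisimulation V 𝔸 ℂ f × SurjectiveOnObjects V 𝔸 ℂ f)
    × (IsFunctionalBisimulation V 𝔹 ℂ g × SurjectiveOnObjects V 𝔹 ℂ g)

module _ {o h r ℓ : Level} {V : Quantaloid o h r ℓ} {𝔸 𝔹 : VCat V} where
  open Simulations V using (cospan-isSimulation; isSimulation-resp-⇔)
  open VFunctor using (fun)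

  bisimilar⇒cospan : Bisimilar V 𝔸 𝔹 → FunctionalBisimulationCospan V 𝔸 𝔹
  bisimilar⇒cospan (R , R-isBisimulation , R-total , R-surjective) =
    quotient , ι₁ , ι₂ , (ι₁-isFunctionalBisimulation , ι₁-surjective R-surjective)
                       , (ι₂-isFunctionalBisimulation , ι₂-surjective R-total)
    where open BisimulationQuotient 𝔸 𝔹 R R-isBisimulation

  cospan⇒bisimilar : FunctionalBisimulationCospan V 𝔸 𝔹 → Bisimilar V 𝔸 𝔹
  cospan⇒bisimilar (ℂ , f , g , (f-fb , f-surjective) , (g-fb , g-surjective)) =
    (λ a b → fun f a ≈ₒ fun g b)
    , ( cospan-isSimulation f g g-fb
      , isSimulation-resp-⇔ ℂ.sym ℂ.sym (cospan-isSimulation g f f-fb))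
    , (λ a → proj₁ (g-surjective (fun f a)) , ℂ.sym (proj₂ (g-surjective (fun f a))))
    , (λ b → f-surjective (fun g b))
    where module ℂ = VCat ℂ
          open ℂ using (_≈ₒ_)

mainTheorem5 : {o h r ℓ : Level} (V : Quantaloid o h r ℓ) (A B : VCat V) →
    Bisimilar V A B ⇔
      (Σ[ C ∈ VCat V ] Σ[ f ∈ VFunctor V A C ] Σ[ g ∈ VFunctor V B C ]
        (IsFunctionalBisimulation V A C f × SurjectiveOnObjects V A C f)
        × (IsFunctionalBisimulation V B C g × SurjectiveOnObjects V B C g))
mainTheorem5 V A B = mk⇔ bisimilar⇒cospan cospan⇒bisimilar
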